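{- Let $G$ be a graph. If $G$ has three pairwise vertex-disjoint induced paths $Q_1,Q_2,Q_3$, each of length $2$, such that the interior vertex of each $Q_i$ has degree $2$ in $G$, then the complement $\overline G$ of $G$ is not a willow.
   Context: The length of a path is its number of edges. For a positive integer $n$, a graph $H$ is an $n$-willow if there exists an oriented tree $T$ with $V(H)\subseteq V(T)$ such that for all distinct $u,v\in V(H)$, $u$ and $v$ are adjacent in $H$ if and only if $T$ has a directed path from $u$ to $v$ or from $v$ to $u$ whose length is not a multiple of $n$. A willow is a graph that is an $n$-willow for some positive integer $n$. -}

module Defs where

open import Data.Nat using (ℕ; zero; suc; _%_; _+_)
open import Data.Fin using (Fin; zero; suc; inject₁; fromℕ; _≟_)
open import Data.Fin.Base using (Fin)
open import Data.Bool using (Bool; true; false; not; if_then_else_)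
open import Data.List using (List; length; filterᵇ)
open import Data.List.Base using (allFin)
open import Data.Product using (Σ; _×_; ∃; ∃-syntax; _,_)
open import Data.Sum using (_⊎_)
open import Relation.Nullary using (¬_; does)
open import Relation.Binary.PropositionalEquality using (_≡_; _≢_)

record Graph (n : ℕ) : Set where
  field
    adj   : Fin n → Fin n → Bool
    sym   : ∀ u v → adj u v ≡ adj v u
    irrefl : ∀ v → adj v v ≡ false
open Graph public

degree : ∀ {n} → Graph n → Fin n → ℕ
degree {n} G v = length (filterᵇ (adj G v) (allFin n))

complement : ∀ {n} → Graph n → Graph n
complement {n} G = record
  { adj = cadj ; sym = csym ; irrefl = cirr }
  where
  cadj : Fin n → Fin n → Bool
  cadj u v = if does (u ≟ v) then false else not (adj G u v)
  csym : ∀ u v → cadj u v ≡ cadj v u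
  csym u v with u ≟ v | v ≟ u
  ... | Relation.Nullary.yes _ | Relation.Nullary.yes _ = _≡_.refl
  ... | Relation.Nullary.yes p | Relation.Nullary.no q = Data.Empty.⊥-elim (q (Relation.Binary.PropositionalEquality.sym p))
    where import Data.Empty
  ... | Relation.Nullary.no p | Relation.Nullary.yes q = Data.Empty.⊥-elim (p (Relation.Binary.PropositionalEquality.sym q))
    where import Data.Empty
  ... | Relation.Nullary.no _ | Relation.Nullary.no _ =
        Relation.Binary.PropositionalEquality.cong not (sym G u v)
  cirr : ∀ v → cadj v v ≡ false
  cirr v with v ≟ v
  ... | Relation.Nullary.yes _ = _≡_.refl
  ... | Relation.Nullary.no ¬p = Data.Empty.⊥-elim (¬p _≡_.refl)
    where import Data.Empty

Distinct : ∀ {k m} → (Fin k → Fin m) → Set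
Distinct p = ∀ i j → p i ≡ p j → i ≡ j

Und : ∀ {m} → (Fin m → Fin m → Set) → Fin m → Fin m → Set
Und D u v = D u v ⊎ D v u

data Walk {m} (D : Fin m → Fin m → Set) : Fin m → Fin m → Set where
  here : ∀ {u} → Walk D u u
  step : ∀ {u w v} → Und D u w → Walk D w v → Walk D u v

Cycle : ∀ {m} → (Fin m → Fin m → Set) → Set
Cycle {m} D = ∃[ j ] Σ (Fin (suc (suc (suc j))) → Fin m) λ c →
    Distinct c
  × (∀ (i : Fin (suc (suc j))) → Und D (c (inject₁ i)) (c (suc i)))
  × Und D (c (fromℕ (suc (suc j)))) (c zero)

-- An oriented tree on vertex set Fin m: an orientation D (no pair of
-- opposite arcs, no loops) whose underlying graph is connected and acyclic.
record OrientedTree (m : ℕ) : Set₁ where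
  field
    arc       : Fin m → Fin m → Set
    oriented  : ∀ u v → arc u v → ¬ arc v u
    connected : ∀ u v → Walk arc u v
    acyclic   : ¬ Cycle arc
open OrientedTree public

DirPath : ∀ {m} → OrientedTree m → Fin m → Fin m → ℕ → Set
DirPath {m} T u v k = Σ (Fin (suc k) → Fin m) λ x →
    Distinct x
  × x zero ≡ u
  × x (fromℕ k) ≡ v
  × (∀ (i : Fin k) → arc T (x (inject₁ i)) (x (suc i)))

NotMultiple : ℕ → ℕ → Set
NotMultiple n k = ¬ (∃[ q ] k ≡ q Data.Nat.* n)
  where import Data.Nat

IsNWillow : ∀ {k} → ℕ → Graph k → Set₁
IsNWillow {k} n H = ∃[ m ] Σ (OrientedTree m) λ T → Σ (Fin k → Fin m) λ f →
    Distinct f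
  × (∀ u v → u ≢ v →
       (adj H u v ≡ true) ⇔′
       (∃[ ℓ ] ((DirPath T (f u) (f v) ℓ ⊎ DirPath T (f v) (f u) ℓ) × NotMultiple n ℓ)))
  where
  _⇔′_ : Set → Set → Set
  A ⇔′ B = (A → B) × (B → A)

IsWillow : ∀ {k} → Graph k → Set₁
IsWillow H = ∃[ n ] (Σ (1 Data.Nat.≤ n) λ _ → IsNWillow n H)
  where import Data.Nat

-- Suppose the complement of G is an n-willow realised in an oriented tree, and call two vertices
-- comparable when a directed path joins them. Let Qᵢ = aᵢbᵢcᵢ. As bᵢ has no G-neighbours besides
-- aᵢ and cᵢ, it is comparable with every vertex of the other two paths; in particular the bᵢ are
-- pairwise comparable, so one of them, b_q, lies on a directed path between the other two. Each of
-- a_q, c_q is comparable with both outer vertices, and since directed paths in an oriented tree are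
-- unique, also with b_q, at distances that are multiples of n because b_q a_q and b_q c_q are edges
-- of G. Among three pairwise comparable vertices of an oriented tree one distance is the sum of the
-- other two, so the distance between a_q and c_q is a multiple of n too, although a_q c_q is not an
-- edge of G.
module Submission where

open import Defs hiding (sym)
open import Data.Nat using (ℕ; zero; suc; _+_; _∸_; _≤_; _<_; _<?_; z≤n; s≤s; s≤s⁻¹)
open import Data.Nat.Properties
  using ( +-comm; +-identityʳ; +-suc; +-monoʳ-<; ≤-total; <-cmp; <⇒≤; >⇒≢
        ; <-trans; <-≤-trans; ≤-<-trans; n<1+n; n≤1+n; m≤m+n; m≤n⇒m<n∨m≡n; m+n≡0⇒m≡0; m+n≡0⇒n≡0
        ; m+[n∸m]≡n; m∸n≤m; n∸n≡0; ∸-monoʳ-<; m<n⇒0<n∸m )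
open import Data.Nat.Divisibility using (_∣_; _∤_; _∣?_; divides; ∣m∣n⇒∣m+n; ∣m+n∣m⇒∣n)
open import Data.Nat.Induction using (<-rec)
open import Data.Fin using (Fin; zero; suc; toℕ; inject₁; fromℕ; fromℕ<; #_; _≟_)
open import Data.Fin.Properties using (toℕ-injective; toℕ<n; toℕ-inject₁; toℕ-fromℕ; toℕ-fromℕ<; any?)
open import Data.Bool using (true; false; not; if_then_else_; T)
open import Data.List using (List; []; _∷_; length; filterᵇ; allFin)
open import Data.List.Membership.Propositional using (_∈_)
open import Data.List.Membership.Propositional.Properties using (∈-filter⁺; ∈-allFin)
open import Data.List.Relation.Unary.Any using (here; there)
open import Data.Product using (_×_; _,_; ∃-syntax; ∃₂; proj₁; proj₂; map₂)
open import Data.Sum using (_⊎_; inj₁; inj₂)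
import Data.Sum as Sum
open import Data.Empty using (⊥; ⊥-elim)
open import Function using (_∘_; flip)
open import Relation.Binary.Definitions using (tri<; tri≈; tri>)
open import Relation.Nullary using (¬_; Dec; yes; no; contradiction)
open import Relation.Nullary.Decidable using (T?; dec-false; _×-dec_)
open import Relation.Binary.PropositionalEquality
  using (_≡_; _≢_; refl; sym; trans; cong; subst; subst₂)

m∸n≡suc[m∸[1+n]] : ∀ {m n} → n < m → m ∸ n ≡ suc (m ∸ suc n)
m∸n≡suc[m∸[1+n]] {suc m} {zero}  _         = refl
m∸n≡suc[m∸[1+n]] {suc m} {suc n} (s≤s n<m) = m∸n≡suc[m∸[1+n]] n<m

∣-triangle : ∀ {n α β γ} → γ ≡ α + β ⊎ α ≡ γ + β ⊎ β ≡ γ + α → n ∣ α → n ∣ γ → n ∣ β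
∣-triangle (inj₁ refl)        n∣α n∣γ = ∣m+n∣m⇒∣n n∣γ n∣α
∣-triangle (inj₂ (inj₁ refl)) n∣α n∣γ = ∣m+n∣m⇒∣n n∣α n∣γ
∣-triangle (inj₂ (inj₂ refl)) n∣α n∣γ = ∣m∣n⇒∣m+n n∣γ n∣α

module _ {V : Set} where

  record Chain (R : V → V → Set) (x : ℕ → V) (k : ℕ) : Set where
    constructor chain
    field link : ∀ i → i < k → R (x i) (x (suc i))
  open Chain public

  record NonBacktracking (x : ℕ → V) (k : ℕ) : Set where
    constructor nonBacktracking
    field noReturn : ∀ i → 2 + i ≤ k → x i ≢ x (2 + i)
  open NonBacktracking public

  chain-map : ∀ {R S : V → V → Set} {x k} → (∀ {u v} → R u v → S u v) → Chain R x k → Chain S x k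
  chain-map f c = chain λ i i<k → f (link c i i<k)

  chain-take : ∀ {R x l k} → l ≤ k → Chain R x k → Chain R x l
  chain-take l≤k c = chain λ i i<l → link c i (<-≤-trans i<l l≤k)

  slice-bound : ∀ {i j t} → i ≤ j → t < j ∸ i → i + t < j
  slice-bound {i} i≤j t<j∸i = subst (i + _ <_) (m+[n∸m]≡n i≤j) (+-monoʳ-< i t<j∸i)

  chain-slice : ∀ {R x k} i j → i ≤ j → j ≤ k → Chain R x k → Chain R (x ∘ (i +_)) (j ∸ i)
  chain-slice {R} {x} i j i≤j j≤k c = chain λ t t<j∸i →
    subst (R (x (i + t)) ∘ x) (sym (+-suc i t)) (link c (i + t) (<-≤-trans (slice-bound i≤j t<j∸i) j≤k))

  nonBacktracking-slice : ∀ {x k} i j → i ≤ j → j ≤ k → NonBacktracking x k →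
                          NonBacktracking (x ∘ (i +_)) (j ∸ i)
  nonBacktracking-slice {x} {k} i j i≤j j≤k nb = nonBacktracking λ t 2+t≤j∸i eq →
    noReturn nb (i + t) (subst (_≤ k) (cong suc (+-suc i t)) (<-≤-trans (slice-bound i≤j 2+t≤j∸i) j≤k))
      (trans eq (cong x (trans (+-suc i (suc t)) (cong suc (+-suc i t)))))

  append : (ℕ → V) → ℕ → (ℕ → V) → ℕ → V
  append x zero    y t       = y t
  append x (suc d) y zero    = x zero
  append x (suc d) y (suc t) = append (x ∘ suc) d y t

  append-head : ∀ x d y → x d ≡ y 0 → append x d y 0 ≡ x 0
  append-head x zero    y x₀≡y₀ = sym x₀≡y₀
  append-head x (suc d) y _     = refl

  append-right : ∀ x d y t → append x d y (d + t) ≡ y t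
  append-right x zero    y t = refl
  append-right x (suc d) y t = append-right (x ∘ suc) d y t

  append-junction : ∀ x d y → append x d y d ≡ y 0
  append-junction x d y = trans (cong (append x d y) (sym (+-identityʳ d))) (append-right x d y 0)

  chain-append : ∀ {R x y} d {e} → x d ≡ y 0 → Chain R x d → Chain R y e → Chain R (append x d y) (d + e)
  chain-append zero _ _ cy = cy
  chain-append {R} {x} {y} (suc d) junction cx cy = chain λ
    { zero    _           → subst (R (x 0)) (sym (append-head (x ∘ suc) d y junction)) (link cx 0 (s≤s z≤n))
    ; (suc i) (s≤s i<d+e) →
        link (chain-append d junction (chain λ j j<d → link cx (suc j) (s≤s j<d)) cy) i i<d+e
    }

  nonBacktracking-append : ∀ {x y} d {e} → x (suc d) ≡ y 0 → x d ≢ y 1 →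
    NonBacktracking x (suc d) → NonBacktracking y e → NonBacktracking (append x (suc d) y) (suc d + e)
  nonBacktracking-append zero _ x₀≢y₁ _ nby = nonBacktracking λ
    { zero    _            → x₀≢y₁
    ; (suc i) (s≤s 2+i≤e) → noReturn nby i 2+i≤e
    }
  nonBacktracking-append {x} {y} (suc d) junction xd≢y₁ nbx nby = nonBacktracking λ
    { zero    _          →
        subst (x 0 ≢_) (sym (append-head (x ∘ (2 +_)) d y junction)) (noReturn nbx 0 (s≤s (s≤s z≤n)))
    ; (suc i) (s≤s 2+i≤) → noReturn (nonBacktracking-append d junction xd≢y₁
                              (nonBacktracking λ j 2+j≤ → noReturn nbx (suc j) (s≤s 2+j≤)) nby) i 2+i≤
    }

  reverse : (ℕ → V) → ℕ → ℕ → V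
  reverse x l t = x (l ∸ t)

  chain-reverse : ∀ {R x l} → Chain R x l → Chain (flip R) (reverse x l) l
  chain-reverse {R} {x} {l} c = chain λ t t<l →
    subst (R (x (l ∸ suc t)) ∘ x) (sym (m∸n≡suc[m∸[1+n]] t<l))
      (link c (l ∸ suc t) (∸-monoʳ-< (s≤s z≤n) t<l))

  nonBacktracking-reverse : ∀ {x l} → NonBacktracking x l → NonBacktracking (reverse x l) l
  nonBacktracking-reverse {x} {l} nb = nonBacktracking λ i 2+i≤l eq →
    let l∸i≡2+s = trans (m∸n≡suc[m∸[1+n]] (<-trans (n<1+n i) 2+i≤l))
                        (cong suc (m∸n≡suc[m∸[1+n]] 2+i≤l))
    in noReturn nb (l ∸ (2 + i)) (subst (_≤ l) l∸i≡2+s (m∸n≤m l i)) (trans (sym eq) (cong x l∸i≡2+s))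

module Forest {m} (E : Fin m → Fin m → Set) (loopless : ∀ v → ¬ E v v) (acyclic : ¬ Cycle E) where

  Repetition : (ℕ → Fin m) → ℕ → Set
  Repetition x L = ∃₂ λ (i j : Fin L) → toℕ i < toℕ j × x (toℕ i) ≡ x (toℕ j)

  repetition? : ∀ x L → Dec (Repetition x L)
  repetition? x L = any? λ i → any? λ j → (toℕ i <? toℕ j) ×-dec (x (toℕ i) ≟ x (toℕ j))

  -- A shortest closed non-backtracking walk of positive length would be a cycle.
  nonBacktracking-closed⇒trivial : ∀ L x → Chain (Und E) x L → NonBacktracking x L → x 0 ≡ x L → L ≡ 0
  nonBacktracking-closed⇒trivial = <-rec _ shortest
    where
    Claim : ℕ → Set
    Claim L = ∀ x → Chain (Und E) x L → NonBacktracking x L → x 0 ≡ x L → L ≡ 0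

    shortest : ∀ L → (∀ {L′} → L′ < L → Claim L′) → Claim L
    shortest zero _ _ _ _ _ = refl
    shortest (suc zero) _ x walk _ closed with link walk 0 (s≤s z≤n)
    ... | inj₁ e = ⊥-elim (loopless (x 1) (subst (λ u → E u (x 1)) closed e))
    ... | inj₂ e = ⊥-elim (loopless (x 1) (subst (E (x 1)) closed e))
    shortest (suc (suc zero)) _ _ _ nb closed = ⊥-elim (noReturn nb 0 (s≤s (s≤s z≤n)) closed)
    shortest L@(suc (suc (suc t))) shorter x walk nb closed with repetition? x L
    ... | yes (i , j , i<j , xᵢ≡xⱼ) =
      contradiction
        (shorter (≤-<-trans (m∸n≤m (toℕ j) (toℕ i)) (toℕ<n j)) (x ∘ (toℕ i +_))
          (chain-slice (toℕ i) (toℕ j) (<⇒≤ i<j) (<⇒≤ (toℕ<n j)) walk)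
          (nonBacktracking-slice (toℕ i) (toℕ j) (<⇒≤ i<j) (<⇒≤ (toℕ<n j)) nb)
          (trans (cong x (+-identityʳ (toℕ i))) (trans xᵢ≡xⱼ (cong x (sym (m+[n∸m]≡n (<⇒≤ i<j)))))))
        (>⇒≢ (m<n⇒0<n∸m i<j))
    ... | no no-repetition = ⊥-elim (acyclic (t , x ∘ toℕ , distinct , edges , closing))
      where
      distinct : Distinct (x ∘ toℕ)
      distinct i j eq with <-cmp (toℕ i) (toℕ j)
      ... | tri< i<j _ _ = contradiction (i , j , i<j , eq) no-repetition
      ... | tri≈ _ i≡j _ = toℕ-injective i≡j
      ... | tri> _ _ j<i = contradiction (j , i , j<i , sym eq) no-repetition
      edges : ∀ (i : Fin (2 + t)) → Und E (x (toℕ (inject₁ i))) (x (suc (toℕ i)))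
      edges i = subst (λ a → Und E (x a) (x (suc (toℕ i)))) (sym (toℕ-inject₁ i))
                  (link walk (toℕ i) (<-trans (toℕ<n i) (n<1+n _)))
      closing : Und E (x (toℕ (fromℕ (2 + t)))) (x 0)
      closing = subst₂ (λ a b → Und E (x a) b) (sym (toℕ-fromℕ (2 + t))) (sym closed)
                  (link walk (2 + t) (n<1+n _))

module OrientedForest {m} (D : Fin m → Fin m → Set)
                        (oriented : ∀ u v → D u v → ¬ D v u) (acyclic : ¬ Cycle D) where

  open Forest D (λ v p → oriented v v p p) acyclic

  chain⇒nonBacktracking : ∀ {x k} → Chain D x k → NonBacktracking x k
  chain⇒nonBacktracking {x} c = nonBacktracking λ i 2+i≤k xᵢ≡x₂₊ᵢ →
    oriented (x i) (x (suc i)) (link c i (<-trans (n<1+n i) 2+i≤k))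
      (subst (D (x (suc i))) (sym xᵢ≡x₂₊ᵢ) (link c (suc i) 2+i≤k))

  closed-chain⇒trivial : ∀ {x k} → Chain D x k → x 0 ≡ x k → k ≡ 0
  closed-chain⇒trivial c = nonBacktracking-closed⇒trivial _ _ (chain-map inj₁ c) (chain⇒nonBacktracking c)

  chain-unique : ∀ k l {x y} → Chain D x k → Chain D y l → x 0 ≡ y 0 → x k ≡ y l →
                 k ≡ l × (∀ i → i ≤ k → x i ≡ y i)
  chain-unique zero zero _ _ x₀≡y₀ _ = refl , λ { zero z≤n → x₀≡y₀ }
  chain-unique zero (suc l) _ cy x₀≡y₀ x₀≡yₗ =
    contradiction (closed-chain⇒trivial cy (trans (sym x₀≡y₀) x₀≡yₗ)) λ ()
  chain-unique (suc k) zero cx _ x₀≡y₀ xₖ≡y₀ =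
    contradiction (closed-chain⇒trivial cx (trans x₀≡y₀ (sym xₖ≡y₀))) λ ()
  chain-unique (suc k) (suc l) {x} {y} cx cy x₀≡y₀ ends with x k ≟ y l
  ... | yes xₖ≡yₗ
    with chain-unique k l (chain-take (n≤1+n k) cx) (chain-take (n≤1+n l) cy) x₀≡y₀ xₖ≡yₗ
  ...   | refl , agree = refl , agree′
    where
    agree′ : ∀ i → i ≤ suc k → x i ≡ y i
    agree′ i i≤1+k with m≤n⇒m<n∨m≡n i≤1+k
    ... | inj₁ i<1+k = agree i (s≤s⁻¹ i<1+k)
    ... | inj₂ refl  = ends
  -- Otherwise x followed by y backwards is a closed walk which does not backtrack, not even at its turning point.
  chain-unique (suc k) (suc l) {x} {y} cx cy x₀≡y₀ ends | no xₖ≢yₗ =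
    contradiction
      (nonBacktracking-closed⇒trivial _ (append x (suc k) (reverse y (suc l)))
        (chain-append (suc k) ends (chain-map inj₁ cx) (chain-map inj₂ (chain-reverse cy)))
        (nonBacktracking-append k ends xₖ≢yₗ (chain⇒nonBacktracking cx)
          (nonBacktracking-reverse (chain⇒nonBacktracking cy)))
        (trans x₀≡y₀ (sym (trans (append-right x (suc k) (reverse y (suc l)) (suc l)) (cong y (n∸n≡0 l))))))
      λ ()

  record Reach (u v : Fin m) (d : ℕ) : Set where
    field
      walk  : ℕ → Fin m
      steps : Chain D walk d
      start : walk 0 ≡ u
      end   : walk d ≡ v
  open Reach public

  Comparable : Fin m → Fin m → ℕ → Set
  Comparable u v d = Reach u v d ⊎ Reach v u d

  _⨾_ : ∀ {u v w d e} → Reach u v d → Reach v w e → Reach u w (d + e)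
  _⨾_ {d = d} {e} p q = record
    { walk  = append (walk p) d (walk q)
    ; steps = chain-append d junction (steps p) (steps q)
    ; start = trans (append-head (walk p) d (walk q) junction) (start p)
    ; end   = trans (append-right (walk p) d (walk q) e) (end q)
    }
    where
    junction = trans (end p) (sym (start q))

  ⨾-junction : ∀ {u v w d e} (p : Reach u v d) (q : Reach v w e) → walk (p ⨾ q) d ≡ v
  ⨾-junction {d = d} p q = trans (append-junction (walk p) d (walk q)) (start q)

  reach-unique : ∀ {u v d e} (p : Reach u v d) (q : Reach u v e) →
                 d ≡ e × (∀ i → i ≤ d → walk p i ≡ walk q i)
  reach-unique p q =
    chain-unique _ _ (steps p) (steps q) (trans (start p) (sym (start q))) (trans (end p) (sym (end q)))

  reach-closed : ∀ {u d} → Reach u u d → d ≡ 0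
  reach-closed p = closed-chain⇒trivial (steps p) (trans (start p) (sym (end p)))

  chain-segment : ∀ {x k} i j → i ≤ j → j ≤ k → Chain D x k → Reach (x i) (x j) (j ∸ i)
  chain-segment {x} i j i≤j j≤k c = record
    { walk  = x ∘ (i +_)
    ; steps = chain-slice i j i≤j j≤k c
    ; start = cong x (+-identityʳ i)
    ; end   = cong x (m+[n∸m]≡n i≤j)
    }

  chain-injective : ∀ {x k} → Chain D x k → ∀ {i j} → i ≤ k → j ≤ k → x i ≡ x j → i ≡ j
  chain-injective {x} c {i} {j} i≤k j≤k xᵢ≡xⱼ with <-cmp i j
  ... | tri< i<j _ _ =
    contradiction (reach-closed (subst (λ u → Reach u (x j) (j ∸ i)) xᵢ≡xⱼ (chain-segment i j (<⇒≤ i<j) j≤k c)))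
                  (>⇒≢ (m<n⇒0<n∸m i<j))
  ... | tri≈ _ i≡j _ = i≡j
  ... | tri> _ _ j<i =
    contradiction (reach-closed (subst (λ u → Reach u (x i) (i ∸ j)) (sym xᵢ≡xⱼ) (chain-segment j i (<⇒≤ j<i) i≤k c)))
                  (>⇒≢ (m<n⇒0<n∸m j<i))

  chain-comparable : ∀ {x k} i j → i ≤ k → j ≤ k → Chain D x k → ∃[ d ] Comparable (x i) (x j) d
  chain-comparable i j i≤k j≤k c with ≤-total i j
  ... | inj₁ i≤j = _ , inj₁ (chain-segment i j i≤j j≤k c)
  ... | inj₂ j≤i = _ , inj₂ (chain-segment j i j≤i i≤k c)

  -- p ⇝ q ⇝ r and p ⇝ a ⇝ r are the same walk, on which q and a both lie.
  common-walk : ∀ {p q r a s t e₁ e₂} → Reach p q s → Reach q r t → Reach p a e₁ → Reach a r e₂ →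
                ∃[ d ] Comparable q a d
  common-walk {a = a} {s} {t} {e₁} {e₂} p⇝q q⇝r p⇝a a⇝r =
    subst₂ (λ u v → ∃[ d ] Comparable u v d) (⨾-junction p⇝q q⇝r) walk-at-e₁≡a
      (chain-comparable s e₁ (m≤m+n s t) e₁≤s+t (steps (p⇝q ⨾ q⇝r)))
    where
    same = reach-unique (p⇝q ⨾ q⇝r) (p⇝a ⨾ a⇝r)
    e₁≤s+t : e₁ ≤ s + t
    e₁≤s+t = subst (e₁ ≤_) (sym (proj₁ same)) (m≤m+n e₁ e₂)
    walk-at-e₁≡a : walk (p⇝q ⨾ q⇝r) e₁ ≡ a
    walk-at-e₁≡a = trans (proj₂ same e₁ e₁≤s+t) (⨾-junction p⇝a a⇝r)

  between : ∀ {p q r a s t e₁ e₂} → Reach p q s → Reach q r t → Comparable p a e₁ → Comparable r a e₂ →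
            ∃[ d ] Comparable q a d
  between p⇝q q⇝r (inj₂ a⇝p) _           = _ , inj₂ (a⇝p ⨾ p⇝q)
  between p⇝q q⇝r (inj₁ _)   (inj₁ r⇝a) = _ , inj₁ (q⇝r ⨾ r⇝a)
  between p⇝q q⇝r (inj₁ p⇝a) (inj₂ a⇝r) = common-walk p⇝q q⇝r p⇝a a⇝r

  reach-cycle : ∀ {x y z α β γ} → Reach x y α → Reach y z β → Reach z x γ → γ ≡ α + β
  reach-cycle {α = α} {β} x⇝y y⇝z z⇝x =
    trans (m+n≡0⇒n≡0 (α + β) total≡0) (sym (m+n≡0⇒m≡0 (α + β) total≡0))
    where
    total≡0 = reach-closed ((x⇝y ⨾ y⇝z) ⨾ z⇝x)

  triangle : ∀ {x y z α β γ} → Comparable x y α → Comparable y z β → Comparable x z γ →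
             γ ≡ α + β ⊎ α ≡ γ + β ⊎ β ≡ γ + α
  triangle (inj₁ x⇝y) (inj₁ y⇝z) (inj₁ x⇝z) = inj₁ (proj₁ (reach-unique x⇝z (x⇝y ⨾ y⇝z)))
  triangle (inj₁ x⇝y) (inj₁ y⇝z) (inj₂ z⇝x) = inj₁ (reach-cycle x⇝y y⇝z z⇝x)
  triangle (inj₁ x⇝y) (inj₂ z⇝y) (inj₁ x⇝z) = inj₂ (inj₁ (proj₁ (reach-unique x⇝y (x⇝z ⨾ z⇝y))))
  triangle (inj₁ x⇝y) (inj₂ z⇝y) (inj₂ z⇝x) = inj₂ (inj₂ (proj₁ (reach-unique z⇝y (z⇝x ⨾ x⇝y))))
  triangle {α = α} {γ = γ} (inj₂ y⇝x) (inj₁ y⇝z) (inj₁ x⇝z) =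
    inj₂ (inj₂ (trans (proj₁ (reach-unique y⇝z (y⇝x ⨾ x⇝z))) (+-comm α γ)))
  triangle {β = β} {γ} (inj₂ y⇝x) (inj₁ y⇝z) (inj₂ z⇝x) =
    inj₂ (inj₁ (trans (proj₁ (reach-unique y⇝x (y⇝z ⨾ z⇝x))) (+-comm β γ)))
  triangle (inj₂ y⇝x) (inj₂ z⇝y) (inj₁ x⇝z) = inj₂ (inj₁ (reach-cycle x⇝z z⇝y y⇝x))
  triangle {α = α} {β} (inj₂ y⇝x) (inj₂ z⇝y) (inj₂ z⇝x) =
    inj₁ (trans (proj₁ (reach-unique z⇝x (z⇝y ⨾ y⇝x))) (+-comm β α))

  no-three-centred-paths : ∀ n (X : Fin 3 → Fin 3 → Fin m) →
    (∀ p q j → p ≢ q → ∃[ ℓ ] Comparable (X p (# 1)) (X q j) ℓ) →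
    (∀ q j {ℓ} → j ≢ # 1 → Comparable (X q (# 1)) (X q j) ℓ → n ∣ ℓ) →
    (∀ q → ∃[ ℓ ] Comparable (X q (# 0)) (X q (# 2)) ℓ × n ∤ ℓ) →
    ⊥
  no-three-centred-paths n X centre-comparable spoke-∣ rim =
    tournament (proj₂ (centre-comparable (# 0) (# 1) (# 1) λ ()))
               (proj₂ (centre-comparable (# 0) (# 2) (# 1) λ ()))
               (proj₂ (centre-comparable (# 1) (# 2) (# 1) λ ()))
    where
    B : Fin 3 → Fin m
    B p = X p (# 1)

    middle : ∀ p q r {s t} → p ≢ q → r ≢ q → Reach (B p) (B q) s → Reach (B q) (B r) t → ⊥
    middle p q r p≢q r≢q p⇝q q⇝r
      with between p⇝q q⇝r (proj₂ (centre-comparable p q (# 0) p≢q)) (proj₂ (centre-comparable r q (# 0) r≢q))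
         | between p⇝q q⇝r (proj₂ (centre-comparable p q (# 2) p≢q)) (proj₂ (centre-comparable r q (# 2) r≢q))
         | rim q
    ... | _ , qa | _ , qc | _ , ac , n∤ℓ =
      n∤ℓ (∣-triangle (triangle qa ac qc) (spoke-∣ q (# 0) (λ ()) qa) (spoke-∣ q (# 2) (λ ()) qc))

    tournament : ∀ {l₁ l₂ l₃} → Comparable (B (# 0)) (B (# 1)) l₁ → Comparable (B (# 0)) (B (# 2)) l₂ →
                 Comparable (B (# 1)) (B (# 2)) l₃ → ⊥
    tournament (inj₁ 0⇝1) _          (inj₁ 1⇝2) = middle (# 0) (# 1) (# 2) (λ ()) (λ ()) 0⇝1 1⇝2
    tournament (inj₁ 0⇝1) (inj₁ 0⇝2) (inj₂ 2⇝1) = middle (# 0) (# 2) (# 1) (λ ()) (λ ()) 0⇝2 2⇝1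
    tournament (inj₁ 0⇝1) (inj₂ 2⇝0) (inj₂ 2⇝1) = middle (# 2) (# 0) (# 1) (λ ()) (λ ()) 2⇝0 0⇝1
    tournament (inj₂ 1⇝0) (inj₁ 0⇝2) (inj₁ 1⇝2) = middle (# 1) (# 0) (# 2) (λ ()) (λ ()) 1⇝0 0⇝2
    tournament (inj₂ 1⇝0) (inj₂ 2⇝0) (inj₁ 1⇝2) = middle (# 1) (# 2) (# 0) (λ ()) (λ ()) 1⇝2 2⇝0
    tournament (inj₂ 1⇝0) _          (inj₂ 2⇝1) = middle (# 2) (# 1) (# 0) (λ ()) (λ ()) 2⇝1 1⇝0

clamp : ∀ k → ℕ → Fin (suc k)
clamp zero    _       = zero
clamp (suc k) zero    = zero
clamp (suc k) (suc t) = suc (clamp k t)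

clamp-toℕ : ∀ {k t} (i : Fin (suc k)) → toℕ i ≡ t → clamp k t ≡ i
clamp-toℕ {zero}  zero    refl = refl
clamp-toℕ {suc k} zero    refl = refl
clamp-toℕ {suc k} (suc i) refl = cong suc (clamp-toℕ i refl)

module _ {m} (T : OrientedTree m) where
  open OrientedForest (arc T) (oriented T) (acyclic T)

  dirPath⇒reach : ∀ {u v k} → DirPath T u v k → Reach u v k
  dirPath⇒reach {k = k} (x , _ , x₀≡u , xₖ≡v , arcs) = record
    { walk  = x ∘ clamp k
    ; steps = chain λ i i<k →
        let j = fromℕ< i<k in
        subst₂ (λ a b → arc T (x a) (x b))
          (sym (clamp-toℕ (inject₁ j) (trans (toℕ-inject₁ j) (toℕ-fromℕ< i<k))))
          (sym (clamp-toℕ (suc j) (cong suc (toℕ-fromℕ< i<k))))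
          (arcs j)
    ; start = trans (cong x (clamp-toℕ zero refl)) x₀≡u
    ; end   = trans (cong x (clamp-toℕ (fromℕ k) (toℕ-fromℕ k))) xₖ≡v
    }

  reach⇒dirPath : ∀ {u v k} → Reach u v k → DirPath T u v k
  reach⇒dirPath {k = k} p =
      walk p ∘ toℕ
    , (λ i j eq → toℕ-injective (chain-injective (steps p) (s≤s⁻¹ (toℕ<n i)) (s≤s⁻¹ (toℕ<n j)) eq))
    , start p
    , trans (cong (walk p) (toℕ-fromℕ k)) (end p)
    , λ j → subst (λ a → arc T (walk p a) (walk p (suc (toℕ j)))) (sym (toℕ-inject₁ j))
              (link (steps p) (toℕ j) (toℕ<n j))

Realises : ∀ {k m} → ℕ → Graph k → OrientedTree m → (Fin k → Fin m) → Set
Realises n H T f = ∀ u v → u ≢ v →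
  let Joined = ∃[ ℓ ] ((DirPath T (f u) (f v) ℓ ⊎ DirPath T (f v) (f u) ℓ) × NotMultiple n ℓ)
  in (adj H u v ≡ true → Joined) × (Joined → adj H u v ≡ true)

module Realisation {k m} (n : ℕ) (H : Graph k) (T : OrientedTree m) (f : Fin k → Fin m)
                   (realises : Realises n H T f) where
  open OrientedForest (arc T) (oriented T) (acyclic T)

  adjacent⇒comparable : ∀ {u v} → u ≢ v → adj H u v ≡ true → ∃[ ℓ ] Comparable (f u) (f v) ℓ × n ∤ ℓ
  adjacent⇒comparable u≢v uv with proj₁ (realises _ _ u≢v) uv
  ... | ℓ , path , not-multiple =
    ℓ , Sum.map (dirPath⇒reach T) (dirPath⇒reach T) path , λ (divides q eq) → not-multiple (q , eq)

  nonadjacent⇒∣ : ∀ {u v ℓ} → u ≢ v → adj H u v ≡ false → Comparable (f u) (f v) ℓ → n ∣ ℓ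
  nonadjacent⇒∣ {ℓ = ℓ} u≢v ¬uv c with n ∣? ℓ
  ... | yes n∣ℓ = n∣ℓ
  ... | no  n∤ℓ = contradiction
    (trans (sym ¬uv) (proj₂ (realises _ _ u≢v)
      (ℓ , Sum.map (reach⇒dirPath T) (reach⇒dirPath T) c , λ (q , eq) → n∤ℓ (divides q eq))))
    λ ()

∈-pair : ∀ {A : Set} {x p q : A} → x ∈ p ∷ q ∷ [] → x ≡ p ⊎ x ≡ q
∈-pair (here x≡p)         = inj₁ x≡p
∈-pair (there (here x≡q)) = inj₂ x≡q

length≡2⇒¬three-distinct : ∀ {A : Set} (xs : List A) {a b c} → length xs ≡ 2 →
  a ∈ xs → b ∈ xs → c ∈ xs → a ≢ b → c ≢ a → c ≢ b → ⊥
length≡2⇒¬three-distinct (_ ∷ _ ∷ []) _ a∈ b∈ c∈ a≢b c≢a c≢b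
  with ∈-pair a∈ | ∈-pair b∈ | ∈-pair c∈
... | inj₁ refl | inj₁ refl | _         = a≢b refl
... | inj₂ refl | inj₂ refl | _         = a≢b refl
... | inj₁ refl | inj₂ refl | inj₁ refl = c≢a refl
... | inj₁ refl | inj₂ refl | inj₂ refl = c≢b refl
... | inj₂ refl | inj₁ refl | inj₁ refl = c≢b refl
... | inj₂ refl | inj₁ refl | inj₂ refl = c≢a refl

module _ {k} (G : Graph k) where

  degree≡2⇒nonadjacent : ∀ {v a c w} → degree G v ≡ 2 → adj G v a ≡ true → adj G v c ≡ true →
                         a ≢ c → w ≢ a → w ≢ c → adj G v w ≡ false
  degree≡2⇒nonadjacent {v} {a} {c} {w} deg va vc a≢c w≢a w≢c with adj G v w in vw
  ... | false = refl
  ... | true  =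
    ⊥-elim (length≡2⇒¬three-distinct _ deg (neighbour va) (neighbour vc) (neighbour vw) a≢c w≢a w≢c)
    where
    neighbour : ∀ {x} → adj G v x ≡ true → x ∈ filterᵇ (adj G v) (allFin k)
    neighbour vx = ∈-filter⁺ (T? ∘ adj G v) (∈-allFin _) (subst T (sym vx) _)

  complement-adj : ∀ {u v b} → u ≢ v → adj G u v ≡ b → adj (complement G) u v ≡ not b
  complement-adj {u} {v} u≢v refl = cong (λ d → if d then false else not (adj G u v)) (dec-false (u ≟ v) u≢v)

proposition9p5 : ∀ {n} (G : Graph n) →
    (Q : Fin 3 → Fin 3 → Fin n) →
    (∀ i j i′ j′ → Q i j ≡ Q i′ j′ → (i ≡ i′) × (j ≡ j′)) →
    (∀ i → adj G (Q i zero) (Q i (suc zero)) ≡ true) →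
    (∀ i → adj G (Q i (suc zero)) (Q i (suc (suc zero))) ≡ true) →
    (∀ i → adj G (Q i zero) (Q i (suc (suc zero))) ≡ false) →
    (∀ i → degree G (Q i (suc zero)) ≡ 2) →
    ¬ IsWillow (complement G)
proposition9p5 G Q Q-injective ab bc ac deg-b (n , _ , _ , T , f , _ , realises) =
  no-three-centred-paths n (λ i j → f (Q i j)) centre-comparable spoke-∣ rim
  where
  open OrientedForest (arc T) (oriented T) (acyclic T)
  open Realisation n (complement G) T f realises

  Q-≢ : ∀ {i j i′ j′} → i ≢ i′ ⊎ j ≢ j′ → Q i j ≢ Q i′ j′
  Q-≢ (inj₁ i≢i′) eq = i≢i′ (proj₁ (Q-injective _ _ _ _ eq))
  Q-≢ (inj₂ j≢j′) eq = j≢j′ (proj₂ (Q-injective _ _ _ _ eq))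

  centre-comparable : ∀ p q j → p ≢ q → ∃[ ℓ ] Comparable (f (Q p (# 1))) (f (Q q j)) ℓ
  centre-comparable p q j p≢q =
    map₂ proj₁ (adjacent⇒comparable (Q-≢ (inj₁ p≢q)) (complement-adj G (Q-≢ (inj₁ p≢q))
      (degree≡2⇒nonadjacent G (deg-b p) (trans (Graph.sym G _ _) (ab p)) (bc p) (Q-≢ (inj₂ λ ()))
        (Q-≢ (inj₁ (p≢q ∘ sym))) (Q-≢ (inj₁ (p≢q ∘ sym))))))

  spoke-∣ : ∀ q j {ℓ} → j ≢ # 1 → Comparable (f (Q q (# 1))) (f (Q q j)) ℓ → n ∣ ℓ
  spoke-∣ q j j≢1 =
    nonadjacent⇒∣ (Q-≢ (inj₂ (j≢1 ∘ sym))) (complement-adj G (Q-≢ (inj₂ (j≢1 ∘ sym))) (centre-adjacent j j≢1))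
    where
    centre-adjacent : ∀ j → j ≢ # 1 → adj G (Q q (# 1)) (Q q j) ≡ true
    centre-adjacent zero             _   = trans (Graph.sym G _ _) (ab q)
    centre-adjacent (suc zero)       j≢1 = contradiction refl j≢1
    centre-adjacent (suc (suc zero)) _   = bc q

  rim : ∀ q → ∃[ ℓ ] Comparable (f (Q q (# 0))) (f (Q q (# 2))) ℓ × n ∤ ℓ
  rim q = adjacent⇒comparable (Q-≢ (inj₂ λ ())) (complement-adj G (Q-≢ (inj₂ λ ())) (ac q))
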